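{- For $n\geq1$, $$\sum_{\pi\in RS_n}t^{\mathrm{asc}(\pi)}u^{\pi_n}=\sum_{e\in\mathbf{I}_n(000)}t^{\mathrm{dist}(e)}u^{e_n+1}.$$
   Context: A permutation $\pi$ of $\{1,\ldots,n\}$ is a Simsun permutation if for every $k\in\{1,\ldots,n\}$ the word obtained from $\pi$ by deleting the values $k+1,\ldots,n$ has no double descent, i.e. no three consecutive letters $w_{i-1}>w_i>w_{i+1}$; $RS_n$ is the set of Simsun permutations of $\{1,\ldots,n\}$. $\mathrm{asc}(\pi)=n-1-\mathrm{des}(\pi)$, where $\mathrm{des}(\pi)$ is the number of $i\in[n-1]$ with $\pi_i>\pi_{i+1}$. $\mathbf{I}_n=\{(e_1,\ldots,e_n): 0\leq e_i<i\}$; $\mathbf{I}_n(000)$ is the set of $e\in\mathbf{I}_n$ with no $i<j<k$ such that $e_i=e_j=e_k$. $\mathrm{dist}(e)$ is the number of distinct positive values among the entries of $e$. -}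

module Defs where

open import Data.Nat using (ℕ; _+_; zero; suc; _≤_; _<_; _>_; _∸_; _≟_; _≤?_; _<?_)
open import Data.List using (List; []; _∷_; _++_; [_]; map; concatMap; upTo; filter; length; last; deduplicate)
open import Data.List.Relation.Unary.All using (All; all?)
open import Data.List.Relation.Unary.Unique.DecPropositional _≟_ using (Unique; unique?)
open import Data.Maybe using (Maybe; just; nothing)
import Data.Maybe as Maybe
open import Data.Maybe.Properties using (≡-dec)
open import Data.Fin using (Fin; toℕ)
open import Data.Fin.Properties using () renaming (all? to allFin?)
open import Data.Product using (_×_; _,_)
open import Data.Bool using (if_then_else_)
open import Data.Unit using (⊤; tt)
open import Relation.Nullary using (does; ¬_; Dec; yes; no; ¬?)
open import Relation.Nullary.Decidable using (_×-dec_; _→-dec_)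
open import Relation.Binary.PropositionalEquality using (_≡_)
open import Data.List.Base using (lookup)

words : ℕ → ℕ → List (List ℕ)
words k zero    = [] ∷ []
words k (suc m) = concatMap (λ w → map (λ x → suc x ∷ w) (upTo k)) (words k m)

-- Permutations of {1,…,n}, as words π₁ π₂ … πₙ (one-line notation):
-- the words of length n over {1,…,n} with pairwise distinct letters.
IsPermWord : List ℕ → Set
IsPermWord = Unique

perms : ℕ → List (List ℕ)
perms n = filter unique? (words n n)

-- 𝐈ₙ = {(e₁,…,eₙ) : 0 ≤ eᵢ < i}, as lists [e₁, …, eₙ].
invSeqs : ℕ → List (List ℕ)
invSeqs zero    = [] ∷ []
invSeqs (suc n) = concatMap (λ e → map (λ x → e ++ [ x ]) (upTo (suc n))) (invSeqs n)

NoDoubleDescent : List ℕ → Set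
NoDoubleDescent (x ∷ y ∷ z ∷ r) = ¬ (x > y × y > z) × NoDoubleDescent (y ∷ z ∷ r)
NoDoubleDescent _               = ⊤

noDoubleDescent? : (w : List ℕ) → Dec (NoDoubleDescent w)
noDoubleDescent? (x ∷ y ∷ z ∷ r) = ¬? ((y <? x) ×-dec (z <? y)) ×-dec noDoubleDescent? (y ∷ z ∷ r)
noDoubleDescent? []              = yes tt
noDoubleDescent? (_ ∷ [])        = yes tt
noDoubleDescent? (_ ∷ _ ∷ [])    = yes tt

restrict : ℕ → List ℕ → List ℕ
restrict k = filter (_≤? k)

Simsun : ℕ → List ℕ → Set
Simsun n w = All (λ k → NoDoubleDescent (restrict k w)) (map suc (upTo n))

simsun? : (n : ℕ) → (w : List ℕ) → Dec (Simsun n w)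
simsun? n w = all? (λ k → noDoubleDescent? (restrict k w)) (map suc (upTo n))

RS : ℕ → List (List ℕ)
RS n = filter (simsun? n) (perms n)

des : List ℕ → ℕ
des (x ∷ y ∷ r) = (if does (y <? x) then 1 else 0) + des (y ∷ r)
des _ = zero

asc : ℕ → List ℕ → ℕ
asc n w = n ∸ 1 ∸ des w

Avoids000 : List ℕ → Set
Avoids000 e = ∀ (i j k : Fin (length e)) → toℕ i < toℕ j → toℕ j < toℕ k →
  ¬ (lookup e i ≡ lookup e j × lookup e j ≡ lookup e k)

avoids000? : (e : List ℕ) → Dec (Avoids000 e)
avoids000? e = allFin? λ i → allFin? λ j → allFin? λ k →
  (toℕ i <? toℕ j) →-dec ((toℕ j <? toℕ k) →-dec
    ¬? ((lookup e i ≟ lookup e j) ×-dec (lookup e j ≟ lookup e k)))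

I000 : ℕ → List (List ℕ)
I000 n = filter avoids000? (invSeqs n)

dist : List ℕ → ℕ
dist e = length (deduplicate _≟_ (filter (0 <?_) e))

countBy : {A : Set} {P : A → Set} → ((x : A) → Dec (P x)) → List A → ℕ
countBy P? xs = length (filter P? xs)

-- Coefficient of t^a u^b in  Σ_{π ∈ RSₙ} t^{asc π} u^{πₙ}.
coeffLHS : ℕ → ℕ → ℕ → ℕ
coeffLHS n a b = countBy (λ π → (asc n π ≟ a) ×-dec ≡-dec _≟_ (last π) (just b)) (RS n)

-- Coefficient of t^a u^b in  Σ_{e ∈ 𝐈ₙ(000)} t^{dist e} u^{eₙ + 1}.
coeffRHS : ℕ → ℕ → ℕ → ℕ
coeffRHS n a b = countBy (λ e → (dist e ≟ a) ×-dec ≡-dec _≟_ (Maybe.map suc (last e)) (just b)) (I000 n)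

-- Both families are generating trees for insertion of a new largest entry. A Simsun
-- permutation of [n+1] arises from exactly one of [n] by inserting n+1 at a slot that creates
-- no double descent; a 000-avoiding inversion sequence of length n+1 arises from exactly one
-- of length n by appending n, or by inserting before its last entry a value occurring at most
-- once. Track the pairs (asc π, πₙ) and (dist e, eₙ + 1). In both trees a node of size n with
-- pair (a, l) has one child (a+1, n+1), k = n-1-a children (a+1, l) and n-2k children (a, l):
-- here k counts the descents of π, respectively the values missing from e. Hence the two
-- multisets of pairs obey the same recursion, and they agree for n = 1.
module Submission where

open import Defs
open import Data.Bool using (Bool; true; false; if_then_else_; T)
open import Data.Empty using (⊥; ⊥-elim)
open import Data.Fin using (Fin; toℕ; zero; suc)
open import Data.List
  using (List; []; _∷_; _++_; [_]; _∷ʳ_; map; concatMap; filter; length; replicate; upTo; last; fromMaybe; deduplicate; lookup)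
import Data.List.Properties as List
open import Data.List.Properties
  using ( length-filter; filter-++; length-++; map-concatMap; concatMap-map; filter-all; filter-accept; filter-reject
        ; filter-some; filter-none; map-++; upTo-∷ʳ; length-map; length-upTo; map-cong-local; ++-assoc; ++-cancelˡ
        ; ∷-injectiveˡ)
open import Data.List.Membership.Propositional using (_∈_; _∉_; find; lose)
open import Data.List.Membership.Propositional.Properties
  using ( ∈-filter⁺; ∈-filter⁻; ∈-map⁺; ∈-map⁻; ∈-concatMap⁺; ∈-concatMap⁻; ∈-upTo⁺; ∈-upTo⁻; ∈-++⁺ˡ; ∈-lookup
        ; ∈-deduplicate⁺; ∈-deduplicate⁻)
open import Data.List.Membership.Propositional.Properties.WithK using (unique∧set⇒bag)
open import Data.List.Relation.Unary.Any using (here; there; index)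
open import Data.List.Relation.Unary.Any.Properties using (lookup-index)
open import Data.List.Relation.Unary.All as All using (All; []; _∷_)
import Data.List.Relation.Unary.All.Properties as All
open import Data.List.Relation.Unary.Unique.Propositional using (Unique; []; _∷_)
import Data.List.Relation.Unary.Unique.Propositional.Properties as Unique
open import Data.List.Relation.Binary.BagAndSetEquality using (∼bag⇒↭)
open import Data.List.Relation.Binary.Permutation.Propositional as ↭
  using (_↭_; ↭-refl; ↭-sym; ↭-trans; ↭-reflexive; module PermutationReasoning)
open import Data.List.Relation.Binary.Permutation.Propositional.Properties as ↭
  using (↭-length; ∈-resp-↭; filter-↭; ++⁺; ++⁺ˡ; shift; shifts)
open import Data.Maybe using (Maybe; just; nothing)
import Data.Maybe as Maybe
open import Data.Maybe.Properties using (just-injective; ≡-dec)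
open import Data.Nat using (ℕ; zero; suc; _+_; _∸_; _≤_; _<_; z≤n; s≤s; _≟_; _≤?_; _<?_)
open import Data.Nat.Properties
  using ( ≤-refl; ≤-trans; ≤-antisym; ≤-pred; ≤-reflexive; <-irrefl; <-asym; <⇒≱; <⇒≯; <⇒≢; ≰⇒>; ≤∧≢⇒<; n≤1+n
        ; m≤n⇒m≤1+n; suc-injective; n≢0⇒n>0; +-suc; +-comm; +-assoc; +-cancelˡ-≡; +-mono-≤; m+n∸n≡m; m+n∸m≡n
        ; +-∸-assoc; m∸[m∸n]≡n; +-commutativeSemigroup)
open import Algebra.Properties.CommutativeSemigroup +-commutativeSemigroup using (interchange)
open import Data.List.Membership.DecPropositional _≟_ using (_∈?_)
open import Data.List.Relation.Unary.Unique.DecPropositional _≟_ using (unique?)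
open import Data.List.Relation.Unary.Unique.DecPropositional.Properties _≟_ using (deduplicate-!)
open import Data.Product using (∃; ∃₂; _×_; _,_; proj₁; proj₂; map₁)
open import Data.Product.Function.NonDependent.Propositional using (_×-⇔_)
open import Data.Sum using (_⊎_; inj₁; inj₂; [_,_]′)
open import Function using (_∘_; _⇔_; mk⇔; Equivalence)
open import Function.Construct.Composition using (_⇔-∘_)
open import Function.Construct.Identity using (⇔-id)
open import Function.Construct.Symmetry using (⇔-sym)
open import Relation.Nullary using (¬_; Dec; yes; no; does; ¬?)
open import Relation.Nullary.Decidable using (T?; _×-dec_; dec-true; dec-false)
open import Relation.Unary using (Decidable)
open import Relation.Binary.PropositionalEquality
  using (_≡_; _≢_; refl; sym; trans; cong; cong₂; subst; module ≡-Reasoning)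

private
  variable
    A B : Set

-- Duplicate-free lists and counting

∈-concatMap⁺′ : (f : A → List B) {xs : List A} {x : A} {y : B} →
  x ∈ xs → y ∈ f x → y ∈ concatMap f xs
∈-concatMap⁺′ f x∈xs y∈fx = ∈-concatMap⁺ f (lose x∈xs y∈fx)

∈-concatMap⁻′ : (f : A → List B) (xs : List A) {y : B} →
  y ∈ concatMap f xs → ∃ λ x → x ∈ xs × y ∈ f x
∈-concatMap⁻′ f xs p = find (∈-concatMap⁻ f {xs} p)

unique∧sameElements⇒↭ : {xs ys : List A} → Unique xs → Unique ys →
  (∀ {z} → z ∈ xs ⇔ z ∈ ys) → xs ↭ ys
unique∧sameElements⇒↭ u v eq = ∼bag⇒↭ (unique∧set⇒bag u v eq)

unique∧⊆⇒length≤ : {xs ys : List ℕ} → Unique xs → Unique ys →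
  (∀ {z} → z ∈ xs → z ∈ ys) → length xs ≤ length ys
unique∧⊆⇒length≤ {xs} {ys} u v xs⊆ys =
  ≤-trans (≤-reflexive (↭-length xs↭ys∩xs)) (length-filter ∈xs? ys)
  where
  ∈xs? : Decidable (_∈ xs)
  ∈xs? = _∈? xs
  xs↭ys∩xs : xs ↭ filter ∈xs? ys
  xs↭ys∩xs = unique∧sameElements⇒↭ u (Unique.filter⁺ ∈xs? v)
    (mk⇔ (λ z∈xs → ∈-filter⁺ ∈xs? (xs⊆ys z∈xs) z∈xs) (proj₂ ∘ ∈-filter⁻ ∈xs? {xs = ys}))

Unique-concatMap⁺ : (f : A → List B) (parent : B → A) {xs : List A} → Unique xs →
  (∀ {x} → x ∈ xs → Unique (f x)) →
  (∀ {x y} → x ∈ xs → y ∈ f x → parent y ≡ x) → Unique (concatMap f xs)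
Unique-concatMap⁺ f parent {[]} [] _ _ = []
Unique-concatMap⁺ f parent {x ∷ xs} (x∉xs ∷ u) uf par =
  Unique.++⁺ (uf (here refl)) (Unique-concatMap⁺ f parent u (uf ∘ there) (par ∘ there)) disjoint
  where
  disjoint : ∀ {y} → ¬ (y ∈ f x × y ∈ concatMap f xs)
  disjoint (y∈fx , y∈rest) with ∈-concatMap⁻′ f xs y∈rest
  ... | x′ , x′∈xs , y∈fx′ =
    All.lookup x∉xs (subst (_∈ xs) (trans (sym (par (there x′∈xs) y∈fx′)) (par (here refl) y∈fx)) x′∈xs) refl

concatMap-↭ : (f : A → List B) {xs ys : List A} → xs ↭ ys → concatMap f xs ↭ concatMap f ys
concatMap-↭ f ↭.refl         = ↭-refl
concatMap-↭ f (↭.prep x p)   = ++⁺ˡ (f x) (concatMap-↭ f p)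
concatMap-↭ f (↭.swap x y p) = ↭-trans (shifts (f x) (f y)) (++⁺ˡ (f y) (++⁺ˡ (f x) (concatMap-↭ f p)))
concatMap-↭ f (↭.trans p q)  = ↭-trans (concatMap-↭ f p) (concatMap-↭ f q)

concatMap-cong-↭ : {f g : A → List B} (xs : List A) → (∀ {x} → x ∈ xs → f x ↭ g x) →
  concatMap f xs ↭ concatMap g xs
concatMap-cong-↭ []       _  = ↭-refl
concatMap-cong-↭ (x ∷ xs) fg = ++⁺ (fg (here refl)) (concatMap-cong-↭ xs (fg ∘ there))

map-concatMap-↭ : (f g : A → B) (children : A → List A) (rule : B → List B) (xs : List A) →
  (∀ {x} → x ∈ xs → map f (children x) ↭ rule (g x)) →
  map f (concatMap children xs) ↭ concatMap rule (map g xs)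
map-concatMap-↭ f g children rule xs stats = begin
  map f (concatMap children xs)        ≡⟨ map-concatMap f children xs ⟩
  concatMap (map f ∘ children) xs      ↭⟨ concatMap-cong-↭ xs stats ⟩
  concatMap (rule ∘ g) xs              ≡⟨ concatMap-map rule g xs ⟨
  concatMap rule (map g xs)            ∎
  where open PermutationReasoning

↭-fromRecursion : (rule : ℕ → A → List A) (S T : ℕ → List A) → S 1 ↭ T 1 →
  (∀ m → S (suc (suc m)) ↭ concatMap (rule (suc m)) (S (suc m))) →
  (∀ m → T (suc (suc m)) ↭ concatMap (rule (suc m)) (T (suc m))) →
  ∀ m → S (suc m) ↭ T (suc m)
↭-fromRecursion rule S T base stepS stepT zero    = base
↭-fromRecursion rule S T base stepS stepT (suc m) =
  ↭-trans (stepS m) (↭-trans (concatMap-↭ (rule (suc m)) (↭-fromRecursion rule S T base stepS stepT m)) (↭-sym (stepT m)))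

filter-map : {P : B → Set} (P? : Decidable P) (f : A → B) (xs : List A) →
  filter P? (map f xs) ≡ map f (filter (P? ∘ f) xs)
filter-map P? f []       = refl
filter-map P? f (x ∷ xs) with does (P? (f x))
... | true  = cong (f x ∷_) (filter-map P? f xs)
... | false = filter-map P? f xs

filter-cong-∈ : {P Q : A → Set} (P? : Decidable P) (Q? : Decidable Q) (xs : List A) →
  (∀ {x} → x ∈ xs → P x ⇔ Q x) → filter P? xs ≡ filter Q? xs
filter-cong-∈ P? Q? []       _   = refl
filter-cong-∈ P? Q? (x ∷ xs) P⇔Q with P? x | Q? x
... | yes _  | yes _  = cong (x ∷_) (filter-cong-∈ P? Q? xs (P⇔Q ∘ there))
... | yes px | no ¬qx = ⊥-elim (¬qx (Equivalence.to (P⇔Q (here refl)) px))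
... | no ¬px | yes qx = ⊥-elim (¬px (Equivalence.from (P⇔Q (here refl)) qx))
... | no _   | no _   = filter-cong-∈ P? Q? xs (P⇔Q ∘ there)

countBy-++ : {P : A → Set} (P? : Decidable P) (xs ys : List A) →
  countBy P? (xs ++ ys) ≡ countBy P? xs + countBy P? ys
countBy-++ P? xs ys = trans (cong length (filter-++ P? xs ys)) (length-++ (filter P? xs))

countBy-map : {P : B → Set} (P? : Decidable P) (f : A → B) (xs : List A) →
  countBy P? (map f xs) ≡ countBy (P? ∘ f) xs
countBy-map P? f []       = refl
countBy-map P? f (x ∷ xs) with does (P? (f x))
... | true  = cong suc (countBy-map P? f xs)
... | false = countBy-map P? f xs

countBy-↭ : {P : A → Set} (P? : Decidable P) {xs ys : List A} → xs ↭ ys → countBy P? xs ≡ countBy P? ys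
countBy-↭ P? p = ↭-length (filter-↭ P? p)

countBy-cong-∈ : {P Q : A → Set} (P? : Decidable P) (Q? : Decidable Q) (xs : List A) →
  (∀ {x} → x ∈ xs → P x ⇔ Q x) → countBy P? xs ≡ countBy Q? xs
countBy-cong-∈ P? Q? xs P⇔Q = cong length (filter-cong-∈ P? Q? xs P⇔Q)

countBy-filter-⊆ : {P Q : A → Set} (P? : Decidable P) (Q? : Decidable Q) (xs : List A) →
  (∀ {x} → P x → Q x) → countBy P? (filter Q? xs) ≡ countBy P? xs
countBy-filter-⊆ P? Q? []       _   = refl
countBy-filter-⊆ P? Q? (x ∷ xs) P⊆Q with Q? x
... | yes _ with P? x
...   | yes _ = cong suc (countBy-filter-⊆ P? Q? xs P⊆Q)
...   | no  _ = countBy-filter-⊆ P? Q? xs P⊆Q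
countBy-filter-⊆ P? Q? (x ∷ xs) P⊆Q | no ¬q with P? x
...   | yes p = ⊥-elim (¬q (P⊆Q p))
...   | no  _ = countBy-filter-⊆ P? Q? xs P⊆Q

countBy+countBy¬≡length : {P : A → Set} (P? : Decidable P) (xs : List A) →
  countBy P? xs + countBy (¬? ∘ P?) xs ≡ length xs
countBy+countBy¬≡length P? []       = refl
countBy+countBy¬≡length P? (x ∷ xs) with P? x
... | yes _ = cong suc (countBy+countBy¬≡length P? xs)
... | no  _ = trans (+-suc _ _) (cong suc (countBy+countBy¬≡length P? xs))

countBy-point : {P Q : A → Set} (P? : Decidable P) (Q? : Decidable Q) {xs : List A} {y : A} →
  Unique xs → y ∈ xs → ¬ P y → Q y → (∀ {x} → x ∈ xs → x ≢ y → P x ⇔ Q x) →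
  countBy Q? xs ≡ suc (countBy P? xs)
countBy-point P? Q? {y ∷ xs} (y∉xs ∷ _) (here refl) ¬py qy P⇔Q with P? y | Q? y
... | yes py | _     = ⊥-elim (¬py py)
... | no _   | no ¬q = ⊥-elim (¬q qy)
... | no _   | yes _ = cong suc (sym (countBy-cong-∈ P? Q? xs λ x∈ → P⇔Q (there x∈) (λ { refl → All.lookup y∉xs x∈ refl })))
countBy-point P? Q? {x ∷ xs} (x∉xs ∷ u) (there y∈) ¬py qy P⇔Q
  with P? x | Q? x | P⇔Q (here refl) (λ { refl → All.lookup x∉xs y∈ refl })
... | yes _  | yes _  | _     = cong suc (countBy-point P? Q? u y∈ ¬py qy (P⇔Q ∘ there))
... | no _   | no _   | _     = countBy-point P? Q? u y∈ ¬py qy (P⇔Q ∘ there)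
... | yes px | no ¬qx | Px⇔Qx = ⊥-elim (¬qx (Equivalence.to Px⇔Qx px))
... | no ¬px | yes qx | Px⇔Qx = ⊥-elim (¬px (Equivalence.from Px⇔Qx qx))

countBy-T?-does : {P : A → Set} (P? : Decidable P) (xs : List A) →
  countBy T? (map (does ∘ P?) xs) ≡ countBy P? xs
countBy-T?-does P? []       = refl
countBy-T?-does P? (x ∷ xs) with P? x
... | yes _ = cong suc (countBy-T?-does P? xs)
... | no  _ = countBy-T?-does P? xs

map-Bool-↭ : (g : Bool → A) (bs : List Bool) →
  map g bs ↭ replicate (countBy T? bs) (g true) ++ replicate (countBy (¬? ∘ T?) bs) (g false)
map-Bool-↭ g []           = ↭-refl
map-Bool-↭ g (true ∷ bs)  = ↭.prep (g true) (map-Bool-↭ g bs)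
map-Bool-↭ g (false ∷ bs) =
  ↭-trans (↭.prep (g false) (map-Bool-↭ g bs)) (↭-sym (shift (g false) (replicate _ (g true)) _))

-- The common generating rule

Stat : Set
Stat = ℕ × Maybe ℕ

offspring : ℕ → Stat → List Stat
offspring m (a , l) = (suc a , just (suc m)) ∷ (replicate k (suc a , l) ++ replicate (m ∸ (k + k)) (a , l))
  where
  k : ℕ
  k = m ∸ 1 ∸ a

offspring-↭ : ∀ m a l (bs : List Bool) → countBy T? bs ≡ m ∸ 1 ∸ a → length bs + countBy T? bs ≡ m →
  (suc a , just (suc m)) ∷ map (λ b → (if b then suc a else a) , l) bs ↭ offspring m (a , l)
offspring-↭ m a l bs trues≡k length+trues≡m =
  ↭.prep _ (↭-trans (map-Bool-↭ (λ b → (if b then suc a else a) , l) bs)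
                  (↭-reflexive (cong₂ (λ i j → replicate i (suc a , l) ++ replicate j (a , l)) trues≡k falses≡)))
  where
  t f k : ℕ
  t = countBy T? bs
  f = countBy (¬? ∘ T?) bs
  k = m ∸ 1 ∸ a
  falses≡ : f ≡ m ∸ (k + k)
  falses≡ = begin
    f                        ≡⟨ sym (m+n∸n≡m f (t + t)) ⟩
    f + (t + t) ∸ (t + t)    ≡⟨ cong (_∸ (t + t)) (sym (+-assoc f t t)) ⟩
    f + t + t ∸ (t + t)      ≡⟨ cong (λ n → n + t ∸ (t + t)) (trans (+-comm f t) (countBy+countBy¬≡length T? bs)) ⟩
    length bs + t ∸ (t + t)  ≡⟨ cong₂ (λ n i → n ∸ (i + i)) length+trues≡m trues≡k ⟩
    m ∸ (k + k)              ∎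
    where open ≡-Reasoning

-- Simsun permutations

InAlphabet : ℕ → ℕ → Set
InAlphabet k x = 0 < x × x ≤ k

∈-words⁻ : ∀ k m {w} → w ∈ words k m → length w ≡ m × All (InAlphabet k) w
∈-words⁻ k zero (here refl) = refl , []
∈-words⁻ k (suc m) w∈ with ∈-concatMap⁻′ (λ w → map (λ x → suc x ∷ w) (upTo k)) (words k m) w∈
... | w′ , w′∈ , w∈map with ∈-map⁻ (λ x → suc x ∷ w′) w∈map
... | x , x∈ , refl with ∈-words⁻ k m w′∈
... | len , alph = cong suc len , (s≤s z≤n , ∈-upTo⁻ x∈) ∷ alph

∈-words⁺ : ∀ k m {w} → length w ≡ m → All (InAlphabet k) w → w ∈ words k m
∈-words⁺ k zero    {[]}        refl []                = here refl
∈-words⁺ k (suc m) {suc x ∷ w} refl ((_ , x<k) ∷ alph) =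
  ∈-concatMap⁺′ (λ w → map (λ x → suc x ∷ w) (upTo k)) (∈-words⁺ k m refl alph)
    (∈-map⁺ (λ x → suc x ∷ w) (∈-upTo⁺ x<k))

Unique-words : ∀ k m → Unique (words k m)
Unique-words k zero    = [] ∷ []
Unique-words k (suc m) = Unique-concatMap⁺ _ tail (Unique-words k m)
  (λ _ → Unique.map⁺ (λ { refl → refl }) (Unique.upTo⁺ k)) tail-child
  where
  tail : List ℕ → List ℕ
  tail []      = []
  tail (_ ∷ w) = w
  tail-child : ∀ {w v} → w ∈ words k m → v ∈ map (λ x → suc x ∷ w) (upTo k) → tail v ≡ w
  tail-child {w} _ v∈ with ∈-map⁻ (λ x → suc x ∷ w) v∈
  ... | _ , _ , refl = refl

IsPerm : ℕ → List ℕ → Set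
IsPerm n w = length w ≡ n × All (InAlphabet n) w × Unique w

∈-RS⁻ : ∀ n {w} → w ∈ RS n → IsPerm n w × Simsun n w
∈-RS⁻ n w∈ with ∈-filter⁻ (simsun? n) w∈
... | w∈perms , simsun with ∈-filter⁻ unique? w∈perms
... | w∈words , u with ∈-words⁻ n n w∈words
... | len , alph = (len , alph , u) , simsun

∈-RS⁺ : ∀ n {w} → IsPerm n w → Simsun n w → w ∈ RS n
∈-RS⁺ n (len , alph , u) simsun = ∈-filter⁺ (simsun? n) (∈-filter⁺ unique? (∈-words⁺ n n len alph) u) simsun

Unique-RS : ∀ n → Unique (RS n)
Unique-RS n = Unique.filter⁺ (simsun? n) (Unique.filter⁺ unique? (Unique-words n n))

max∈perm : ∀ m {w} → IsPerm (suc m) w → suc m ∈ w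
max∈perm m {w} (len , alph , u) with suc m ∈? w
... | yes p   = p
... | no  m+1∉w = ⊥-elim (<-irrefl refl (subst (_≤ m) len (subst (length w ≤_) lengthSmall
                    (unique∧⊆⇒length≤ u (Unique.map⁺ suc-injective (Unique.upTo⁺ m)) w⊆small))))
  where
  lengthSmall : length (map suc (upTo m)) ≡ m
  lengthSmall = trans (length-map suc (upTo m)) (length-upTo m)
  w⊆small : ∀ {z} → z ∈ w → z ∈ map suc (upTo m)
  w⊆small {z} z∈w with All.lookup alph z∈w | z ≟ suc m
  ... | _ | yes refl = ⊥-elim (m+1∉w z∈w)
  ... | (s≤s z≤n , z≤m+1) | no z≢m+1 = ∈-map⁺ suc (∈-upTo⁺ (≤-pred (≤∧≢⇒< z≤m+1 z≢m+1)))

insertions : ℕ → List ℕ → List (List ℕ)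
insertions N []       = [ N ] ∷ []
insertions N (x ∷ xs) = (N ∷ x ∷ xs) ∷ map (x ∷_) (insertions N xs)

∈-insertions⁻ : ∀ {N x xs w} → w ∈ insertions N (x ∷ xs) →
  w ≡ N ∷ x ∷ xs ⊎ ∃ λ w′ → w′ ∈ insertions N xs × w ≡ x ∷ w′
∈-insertions⁻ (here refl) = inj₁ refl
∈-insertions⁻ {x = x} (there w∈) with ∈-map⁻ (x ∷_) w∈
... | w′ , w′∈ , refl = inj₂ (w′ , w′∈ , refl)

front∈insertions : ∀ N π → N ∷ π ∈ insertions N π
front∈insertions N []      = here refl
front∈insertions N (_ ∷ _) = here refl

length-∈-insertions : ∀ {N} π {w} → w ∈ insertions N π → length w ≡ suc (length π)
length-∈-insertions []      (here refl) = refl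
length-∈-insertions (x ∷ π) w∈ with ∈-insertions⁻ w∈
... | inj₁ refl              = refl
... | inj₂ (w′ , w′∈ , refl) = cong suc (length-∈-insertions π w′∈)

∈-∈-insertions : ∀ {N} π {w z} → w ∈ insertions N π → z ∈ w → z ≡ N ⊎ z ∈ π
∈-∈-insertions []      (here refl) (here refl) = inj₁ refl
∈-∈-insertions (x ∷ π) w∈ z∈w with ∈-insertions⁻ w∈ | z∈w
... | inj₁ refl              | here refl = inj₁ refl
... | inj₁ refl              | there z∈  = inj₂ z∈
... | inj₂ (w′ , w′∈ , refl) | here refl = inj₂ (here refl)
... | inj₂ (w′ , w′∈ , refl) | there z∈ with ∈-∈-insertions π w′∈ z∈
...   | inj₁ z≡N  = inj₁ z≡N
...   | inj₂ z∈π  = inj₂ (there z∈π)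

All-∈-insertions : ∀ {P : ℕ → Set} {N} π {w} → P N → All P π → w ∈ insertions N π → All P w
All-∈-insertions π PN Pπ w∈ =
  All.tabulate λ z∈w → [ (λ { refl → PN }) , All.lookup Pπ ]′ (∈-∈-insertions π w∈ z∈w)

Unique-∈-insertions : ∀ {N} π {w} → N ∉ π → Unique π → w ∈ insertions N π → Unique w
Unique-∈-insertions []      _   _ (here refl) = [] ∷ []
Unique-∈-insertions {N} (x ∷ π) N∉ u w∈ with ∈-insertions⁻ w∈ | u
... | inj₁ refl              | u′ = All.tabulate (λ { z∈ refl → N∉ z∈ }) ∷ u′
... | inj₂ (w′ , w′∈ , refl) | x∉π ∷ uπ =
  All.tabulate (λ z∈w′ x≡z → x∉w′ x≡z (∈-∈-insertions π w′∈ z∈w′)) ∷ Unique-∈-insertions π (N∉ ∘ there) uπ w′∈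
  where
  x∉w′ : ∀ {z} → x ≡ z → z ≡ N ⊎ z ∈ π → ⊥
  x∉w′ refl (inj₁ refl) = N∉ (here refl)
  x∉w′ refl (inj₂ x∈π)  = All.lookup x∉π x∈π refl

Unique-insertions : ∀ {N} π → N ∉ π → Unique (insertions N π)
Unique-insertions []      _  = [] ∷ []
Unique-insertions {N} (x ∷ π) N∉ =
  All.tabulate first≢ ∷ Unique.map⁺ (λ { refl → refl }) (Unique-insertions π (N∉ ∘ there))
  where
  first≢ : ∀ {w} → w ∈ map (x ∷_) (insertions N π) → ¬ N ∷ x ∷ π ≡ w
  first≢ w∈ refl with ∈-map⁻ (x ∷_) w∈
  ... | _ , _ , refl = N∉ (here refl)

restrict-all : ∀ {k w} → All (_≤ k) w → restrict k w ≡ w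
restrict-all {k} = filter-all (_≤? k)

restrict-restrict : ∀ {k m} → k ≤ m → ∀ w → restrict k (restrict m w) ≡ restrict k w
restrict-restrict k≤m [] = refl
restrict-restrict {k} {m} k≤m (x ∷ w) with x ≤? m
... | yes x≤m rewrite filter-accept (_≤? m) {xs = w} x≤m with x ≤? k
...   | yes x≤k rewrite filter-accept (_≤? k) {xs = restrict m w} x≤k | filter-accept (_≤? k) {xs = w} x≤k
  = cong (x ∷_) (restrict-restrict k≤m w)
...   | no x≰k rewrite filter-reject (_≤? k) {xs = restrict m w} x≰k | filter-reject (_≤? k) {xs = w} x≰k
  = restrict-restrict k≤m w
restrict-restrict {k} {m} k≤m (x ∷ w) | no x≰m rewrite filter-reject (_≤? m) {xs = w} x≰m with x ≤? k
... | yes x≤k = ⊥-elim (x≰m (≤-trans x≤k k≤m))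
... | no x≰k rewrite filter-reject (_≤? k) {xs = w} x≰k = restrict-restrict k≤m w

restrict-∈-insertions : ∀ {k m} → k ≤ m → ∀ π {w} → w ∈ insertions (suc m) π → restrict k w ≡ restrict k π
restrict-∈-insertions {k} k≤m [] (here refl) = filter-reject (_≤? k) (<⇒≱ (s≤s k≤m))
restrict-∈-insertions {k} k≤m (x ∷ π) w∈ with ∈-insertions⁻ w∈
... | inj₁ refl = filter-reject (_≤? k) (<⇒≱ (s≤s k≤m))
... | inj₂ (w′ , w′∈ , refl) with x ≤? k
...   | yes x≤k rewrite filter-accept (_≤? k) {xs = w′} x≤k | filter-accept (_≤? k) {xs = π} x≤k
  = cong (x ∷_) (restrict-∈-insertions k≤m π w′∈)
...   | no x≰k rewrite filter-reject (_≤? k) {xs = w′} x≰k | filter-reject (_≤? k) {xs = π} x≰k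
  = restrict-∈-insertions k≤m π w′∈

∈-insertions-restrict : ∀ m w → Unique w → All (_≤ suc m) w → suc m ∈ w → w ∈ insertions (suc m) (restrict m w)
∈-insertions-restrict m (x ∷ w) (x∉w ∷ _) (_ ∷ w≤) (here refl)
  rewrite filter-reject (_≤? m) {xs = w} (<-irrefl refl)
        | restrict-all {m} {w} (All.zipWith (λ (m+1≢z , z≤m+1) → ≤-pred (≤∧≢⇒< z≤m+1 (m+1≢z ∘ sym))) (x∉w , w≤))
  = front∈insertions (suc m) w
∈-insertions-restrict m (x ∷ w) (x∉w ∷ u) (x≤m+1 ∷ w≤) (there m+1∈w) with x ≤? m
... | yes x≤m rewrite filter-accept (_≤? m) {xs = w} x≤m =
  there (∈-map⁺ (x ∷_) (∈-insertions-restrict m w u w≤ m+1∈w))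
... | no x≰m = ⊥-elim (All.lookup x∉w m+1∈w (≤-antisym x≤m+1 (≰⇒> x≰m)))

private
  map-suc-upTo-suc : ∀ m → map suc (upTo (suc m)) ≡ map suc (upTo m) ++ [ suc m ]
  map-suc-upTo-suc m = trans (cong (map suc) (sym (upTo-∷ʳ m))) (map-++ suc (upTo m) [ m ])

  ≤-∈-map-suc-upTo : ∀ {m k} → k ∈ map suc (upTo m) → k ≤ m
  ≤-∈-map-suc-upTo k∈ with ∈-map⁻ suc k∈
  ... | _ , j∈ , refl = ∈-upTo⁻ j∈

Simsun-suc⁻ : ∀ m {w} → All (_≤ suc m) w → Simsun (suc m) w → Simsun m (restrict m w) × NoDoubleDescent w
Simsun-suc⁻ m {w} w≤ simsun
  with All.++⁻ (map suc (upTo m)) (subst (All (λ k → NoDoubleDescent (restrict k w))) (map-suc-upTo-suc m) simsun)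
... | smaller , ndd ∷ [] =
  All.tabulate (λ k∈ → subst NoDoubleDescent (sym (restrict-restrict (≤-∈-map-suc-upTo k∈) w)) (All.lookup smaller k∈)) ,
  subst NoDoubleDescent (restrict-all w≤) ndd

Simsun-suc⁺ : ∀ m {w} → All (_≤ suc m) w → Simsun m (restrict m w) → NoDoubleDescent w → Simsun (suc m) w
Simsun-suc⁺ m {w} w≤ simsun ndd = subst (All (λ k → NoDoubleDescent (restrict k w))) (sym (map-suc-upTo-suc m))
  (All.++⁺ (All.tabulate (λ k∈ → subst NoDoubleDescent (restrict-restrict (≤-∈-map-suc-upTo k∈) w) (All.lookup simsun k∈)))
           (subst NoDoubleDescent (sym (restrict-all w≤)) ndd ∷ []))

simsunChildren : ℕ → List ℕ → List (List ℕ)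
simsunChildren m π = filter noDoubleDescent? (insertions (suc m) π)

private
  max∉perm : ∀ {m π} → IsPerm m π → suc m ∉ π
  max∉perm (_ , alph , _) m+1∈ = <-irrefl refl (proj₂ (All.lookup alph m+1∈))

restrict-∈-simsunChildren : ∀ m {π w} → π ∈ RS m → w ∈ simsunChildren m π → restrict m w ≡ π
restrict-∈-simsunChildren m {π} π∈ w∈ =
  trans (restrict-∈-insertions ≤-refl π (proj₁ (∈-filter⁻ noDoubleDescent? w∈)))
        (restrict-all (All.map proj₂ (proj₁ (proj₂ (proj₁ (∈-RS⁻ m π∈))))))

RS-suc⊆children : ∀ m {w} → w ∈ RS (suc m) → w ∈ concatMap (simsunChildren m) (RS m)
RS-suc⊆children m {w} w∈ with ∈-RS⁻ (suc m) w∈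
... | perm@(len , alph , u) , simsun =
  ∈-concatMap⁺′ (simsunChildren m) (∈-RS⁺ m permπ (proj₁ simsunπ∧ndd)) (∈-filter⁺ noDoubleDescent? w∈children (proj₂ simsunπ∧ndd))
  where
  w≤ : All (_≤ suc m) w
  w≤ = All.map proj₂ alph
  w∈children : w ∈ insertions (suc m) (restrict m w)
  w∈children = ∈-insertions-restrict m w u w≤ (max∈perm m perm)
  simsunπ∧ndd : Simsun m (restrict m w) × NoDoubleDescent w
  simsunπ∧ndd = Simsun-suc⁻ m w≤ simsun
  permπ : IsPerm m (restrict m w)
  permπ = suc-injective (trans (sym (length-∈-insertions (restrict m w) w∈children)) len) ,
          All.tabulate (λ z∈ → let z∈w , z≤m = ∈-filter⁻ (_≤? m) {xs = w} z∈ in proj₁ (All.lookup alph z∈w) , z≤m) ,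
          Unique.filter⁺ (_≤? m) u

children⊆RS-suc : ∀ m {w} → w ∈ concatMap (simsunChildren m) (RS m) → w ∈ RS (suc m)
children⊆RS-suc m {w} w∈ with ∈-concatMap⁻′ (simsunChildren m) (RS m) w∈
... | π , π∈ , w∈children with ∈-filter⁻ noDoubleDescent? w∈children | ∈-RS⁻ m π∈
...   | w∈ins , ndd | perm@(len , alph , u) , simsun =
  ∈-RS⁺ (suc m)
    ( trans (length-∈-insertions π w∈ins) (cong suc len)
    , All-∈-insertions π (s≤s z≤n , ≤-refl) (All.map (λ (pos , x≤m) → pos , m≤n⇒m≤1+n x≤m) alph) w∈ins
    , Unique-∈-insertions π (max∉perm perm) u w∈ins )
    (Simsun-suc⁺ m (All-∈-insertions π ≤-refl (All.map (m≤n⇒m≤1+n ∘ proj₂) alph) w∈ins)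
      (subst (Simsun m) (sym (restrict-∈-simsunChildren m π∈ w∈children)) simsun) ndd)

RS-suc-↭ : ∀ m → RS (suc m) ↭ concatMap (simsunChildren m) (RS m)
RS-suc-↭ m = unique∧sameElements⇒↭ (Unique-RS (suc m))
  (Unique-concatMap⁺ (simsunChildren m) (restrict m) (Unique-RS m)
    (λ π∈ → Unique.filter⁺ noDoubleDescent? (Unique-insertions _ (max∉perm (proj₁ (∈-RS⁻ m π∈)))))
    (restrict-∈-simsunChildren m))
  (mk⇔ (RS-suc⊆children m) (children⊆RS-suc m))

-- Descents after inserting a new maximum

descentInto : Maybe ℕ → ℕ → Bool
descentInto nothing  x = false
descentInto (just y) x = does (x <? y)

startsWithDescent : List ℕ → Bool
startsWithDescent (x ∷ z ∷ _) = does (z <? x)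
startsWithDescent _           = false

-- π is analysed letter by letter, p being the letter (if any) that precedes it. Inserting a new
-- maximum keeps the word free of double descents exactly at the end and before each xᵢ that is
-- not a descent top. The flag of the slot before xᵢ records whether xᵢ is the bottom of a
-- descent, which is exactly when the insertion leaves the number of descents unchanged
-- (otherwise it grows by one); the end slot never changes it.
insertionFlags : Maybe ℕ → List ℕ → List Bool
insertionFlags p []      = []
insertionFlags p (x ∷ r) =
  (if startsWithDescent (x ∷ r) then [] else [ descentInto p x ]) ++ insertionFlags (just x) r

des-fromMaybe : ∀ p x w → des (fromMaybe p ++ x ∷ w) ≡ (if descentInto p x then 1 else 0) + des (x ∷ w)
des-fromMaybe nothing  _ _ = refl
des-fromMaybe (just _) _ _ = refl

NoDoubleDescent-fromMaybe⁻ : ∀ p {w} → NoDoubleDescent (fromMaybe p ++ w) → NoDoubleDescent w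
NoDoubleDescent-fromMaybe⁻ nothing  ndd = ndd
NoDoubleDescent-fromMaybe⁻ (just _) {[]}            _   = _
NoDoubleDescent-fromMaybe⁻ (just _) {_ ∷ []}        _   = _
NoDoubleDescent-fromMaybe⁻ (just _) {_ ∷ _ ∷ _}     ndd = proj₂ ndd

private
  countBy-T?-[_] : ∀ b → countBy T? [ b ] ≡ (if b then 1 else 0)
  countBy-T?-[ true  ] = refl
  countBy-T?-[ false ] = refl

  trues-firstFlag : ∀ p x r → NoDoubleDescent (fromMaybe p ++ x ∷ r) →
    countBy T? (if startsWithDescent (x ∷ r) then [] else [ descentInto p x ]) ≡ (if descentInto p x then 1 else 0)
  trues-firstFlag p x []      _ = countBy-T?-[ descentInto p x ]
  trues-firstFlag p x (z ∷ r) ndd with z <? x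
  ... | no  z≮x rewrite dec-false (z <? x) z≮x = countBy-T?-[ descentInto p x ]
  ... | yes z<x rewrite dec-true (z <? x) z<x = sym (noDescentInto p ndd)
    where
    noDescentInto : ∀ p → NoDoubleDescent (fromMaybe p ++ x ∷ z ∷ r) → (if descentInto p x then 1 else 0) ≡ 0
    noDescentInto nothing  _   = refl
    noDescentInto (just y) ndd rewrite dec-false (x <? y) (λ x<y → proj₁ ndd (x<y , z<x)) = refl

trues-insertionFlags : ∀ p π → NoDoubleDescent (fromMaybe p ++ π) →
  countBy T? (insertionFlags p π) ≡ des (fromMaybe p ++ π)
trues-insertionFlags nothing  []      _   = refl
trues-insertionFlags (just _) []      _   = refl
trues-insertionFlags p        (x ∷ r) ndd = begin
  countBy T? (insertionFlags p (x ∷ r))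
    ≡⟨ countBy-++ T? (if startsWithDescent (x ∷ r) then [] else [ descentInto p x ]) (insertionFlags (just x) r) ⟩
  countBy T? (if startsWithDescent (x ∷ r) then [] else [ descentInto p x ]) + countBy T? (insertionFlags (just x) r)
    ≡⟨ cong₂ _+_ (trues-firstFlag p x r ndd) (trues-insertionFlags (just x) r (NoDoubleDescent-fromMaybe⁻ p ndd)) ⟩
  (if descentInto p x then 1 else 0) + des (x ∷ r)
    ≡⟨ sym (des-fromMaybe p x r) ⟩
  des (fromMaybe p ++ x ∷ r) ∎
  where open ≡-Reasoning

private
  length-firstSlot : ∀ (s b : Bool) → length (if s then [] else [ b ]) + (if s then 1 else 0) ≡ 1
  length-firstSlot true  _ = refl
  length-firstSlot false _ = refl

length-insertionFlags : ∀ p π → length (insertionFlags p π) + des π ≡ length π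
length-insertionFlags p []          = refl
length-insertionFlags p (x ∷ [])    = refl
length-insertionFlags p (x ∷ z ∷ r) = begin
  length (first ++ rest) + (descentAtX + des (z ∷ r))    ≡⟨ cong (_+ (descentAtX + des (z ∷ r))) (length-++ first) ⟩
  length first + length rest + (descentAtX + des (z ∷ r)) ≡⟨ interchange (length first) (length rest) descentAtX (des (z ∷ r)) ⟩
  length first + descentAtX + (length rest + des (z ∷ r)) ≡⟨ cong₂ _+_ (length-firstSlot (does (z <? x)) (descentInto p x))
                                                                        (length-insertionFlags (just x) (z ∷ r)) ⟩
  suc (length (z ∷ r))                                   ∎
  where
  open ≡-Reasoning
  first rest : List Bool
  first = if does (z <? x) then [] else [ descentInto p x ]
  rest  = insertionFlags (just x) (z ∷ r)
  descentAtX : ℕ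
  descentAtX = if does (z <? x) then 1 else 0

desLast : Maybe ℕ → List ℕ → Stat
desLast p w = des (fromMaybe p ++ w) , last w

flagged : ℕ → Maybe ℕ → Bool → Stat
flagged d l b = (if b then d else suc d) , l

validInsertions : ℕ → Maybe ℕ → List ℕ → List (List ℕ)
validInsertions N p π = filter (λ w → noDoubleDescent? (fromMaybe p ++ w)) (insertions N π)

private
  des-fromMaybe-max : ∀ {N} p x r → All (_< N) (fromMaybe p) → x < N →
    des (fromMaybe p ++ N ∷ x ∷ r) ≡ suc (des (x ∷ r))
  des-fromMaybe-max nothing x r _ x<N rewrite dec-true (x <? _) x<N = refl
  des-fromMaybe-max {N} (just y) x r (y<N ∷ []) x<N
    rewrite dec-false (N <? y) (<⇒≯ y<N) | dec-true (x <? N) x<N = refl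

  flagged-descentInto : ∀ (s : Bool) k l → flagged ((if s then 1 else 0) + k) l s ≡ (suc k , l)
  flagged-descentInto true  _ _ = refl
  flagged-descentInto false _ _ = refl

  desLast-insertFront : ∀ {N} p x r → All (_< N) (fromMaybe p) → x < N →
    desLast p (N ∷ x ∷ r) ≡ flagged (des (fromMaybe p ++ x ∷ r)) (last (x ∷ r)) (descentInto p x)
  desLast-insertFront {N} p x r p<N x<N = begin
    desLast p (N ∷ x ∷ r)
      ≡⟨ cong (_, last (x ∷ r)) (des-fromMaybe-max p x r p<N x<N) ⟩
    suc (des (x ∷ r)) , last (x ∷ r)
      ≡⟨ flagged-descentInto (descentInto p x) (des (x ∷ r)) (last (x ∷ r)) ⟨
    flagged ((if descentInto p x then 1 else 0) + des (x ∷ r)) (last (x ∷ r)) (descentInto p x)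
      ≡⟨ cong (λ d → flagged d (last (x ∷ r)) (descentInto p x)) (des-fromMaybe p x r) ⟨
    flagged (des (fromMaybe p ++ x ∷ r)) (last (x ∷ r)) (descentInto p x) ∎
    where open ≡-Reasoning

  NoDoubleDescent-fromMaybe-max : ∀ {N} p {w} → All (_< N) (fromMaybe p) → NoDoubleDescent (N ∷ w) →
    NoDoubleDescent (fromMaybe p ++ N ∷ w)
  NoDoubleDescent-fromMaybe-max nothing  _                ndd = ndd
  NoDoubleDescent-fromMaybe-max (just y) {[]}    _                _   = _
  NoDoubleDescent-fromMaybe-max (just y) {_ ∷ _} (y<N ∷ []) ndd = (λ (N<y , _) → <-asym N<y y<N) , ndd

  firstInsertion : ∀ {N} p x r → All (_< N) (fromMaybe p) → x < N → NoDoubleDescent (fromMaybe p ++ x ∷ r) →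
    map (desLast p) (filter (λ w → noDoubleDescent? (fromMaybe p ++ w)) [ N ∷ x ∷ r ])
      ≡ map (flagged (des (fromMaybe p ++ x ∷ r)) (last (x ∷ r)))
            (if startsWithDescent (x ∷ r) then [] else [ descentInto p x ])
  firstInsertion {N} p x [] p<N x<N _ =
    trans (cong (map (desLast p)) (filter-accept (λ w → noDoubleDescent? (fromMaybe p ++ w))
                                    (NoDoubleDescent-fromMaybe-max p p<N _)))
          (cong [_] (desLast-insertFront p x [] p<N x<N))
  firstInsertion {N} p x (z ∷ r) p<N x<N ndd with z <? x
  ... | yes z<x =
    trans (cong (map (desLast p)) (filter-reject (λ w → noDoubleDescent? (fromMaybe p ++ w))
                                    (λ ndd′ → proj₁ (NoDoubleDescent-fromMaybe⁻ p ndd′) (x<N , z<x))))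
          (cong (λ s → map (flagged (des (fromMaybe p ++ x ∷ z ∷ r)) (last (z ∷ r)))
                           (if s then [] else [ descentInto p x ]))
                (sym (dec-true (z <? x) z<x)))
  ... | no z≮x =
    trans (cong (map (desLast p)) (filter-accept (λ w → noDoubleDescent? (fromMaybe p ++ w))
                                    (NoDoubleDescent-fromMaybe-max p p<N
                                      ((λ (_ , z<x) → z≮x z<x) , NoDoubleDescent-fromMaybe⁻ p ndd))))
    (trans (cong [_] (desLast-insertFront p x (z ∷ r) p<N x<N))
           (cong (λ s → map (flagged (des (fromMaybe p ++ x ∷ z ∷ r)) (last (z ∷ r)))
                            (if s then [] else [ descentInto p x ]))
                 (sym (dec-false (z <? x) z≮x))))

  NoDoubleDescent-fromMaybe-∷-insertion : ∀ {N} p x r {w} → x < N → NoDoubleDescent (fromMaybe p ++ x ∷ r) →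
    w ∈ insertions N r → NoDoubleDescent (x ∷ w) → NoDoubleDescent (fromMaybe p ++ x ∷ w)
  NoDoubleDescent-fromMaybe-∷-insertion nothing  x r       _   _    _           ndd = ndd
  NoDoubleDescent-fromMaybe-∷-insertion (just y) x []      x<N _    (here refl) ndd = (λ (_ , N<x) → <-asym N<x x<N) , ndd
  NoDoubleDescent-fromMaybe-∷-insertion (just y) x (z ∷ r) x<N nddr w∈          ndd with ∈-insertions⁻ w∈
  ... | inj₁ refl              = (λ (_ , N<x) → <-asym N<x x<N) , ndd
  ... | inj₂ (w′ , _ , refl)   = proj₁ nddr , ndd

  validInsertions-∷ : ∀ {N} p x r → x < N → NoDoubleDescent (fromMaybe p ++ x ∷ r) →
    filter (λ w → noDoubleDescent? (fromMaybe p ++ w)) (map (x ∷_) (insertions N r))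
      ≡ map (x ∷_) (validInsertions N (just x) r)
  validInsertions-∷ {N} p x r x<N ndd =
    trans (filter-map (λ w → noDoubleDescent? (fromMaybe p ++ w)) (x ∷_) (insertions N r))
          (cong (map (x ∷_)) (filter-cong-∈ _ _ (insertions N r) λ w∈ →
            mk⇔ (NoDoubleDescent-fromMaybe⁻ p) (NoDoubleDescent-fromMaybe-∷-insertion p x r x<N ndd w∈)))

  desLast-∷-insertion : ∀ {N} p x r {w} → w ∈ insertions N r →
    desLast p (x ∷ w) ≡ map₁ ((if descentInto p x then 1 else 0) +_) (desLast (just x) w)
  desLast-∷-insertion p x r {[]}    w∈ with () ← length-∈-insertions r w∈
  desLast-∷-insertion p x r {y ∷ w} _  = cong (_, last (x ∷ y ∷ w)) (des-fromMaybe p x (y ∷ w))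

  flagged-shift : ∀ k d l (f : Bool) → map₁ (k +_) (flagged d l f) ≡ flagged (k + d) l f
  flagged-shift k d l true  = refl
  flagged-shift k d l false = cong (_, l) (+-suc k d)

  flagged-last-∷ : ∀ x r d →
    map (flagged d (last r)) (insertionFlags (just x) r) ≡ map (flagged d (last (x ∷ r))) (insertionFlags (just x) r)
  flagged-last-∷ x []      d = refl
  flagged-last-∷ x (_ ∷ _) d = refl

  desLast-∷-validInsertions : ∀ {N} p x r →
    map (desLast (just x)) (validInsertions N (just x) r)
      ≡ map (flagged (des (x ∷ r)) (last r)) (insertionFlags (just x) r) ++ [ des (x ∷ r) , just N ] →
    map (desLast p) (map (x ∷_) (validInsertions N (just x) r))
      ≡ map (flagged (des (fromMaybe p ++ x ∷ r)) (last (x ∷ r))) (insertionFlags (just x) r)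
          ++ [ des (fromMaybe p ++ x ∷ r) , just N ]
  desLast-∷-validInsertions {N} p x r stats = begin
    map (desLast p) (map (x ∷_) children)
      ≡⟨ List.map-∘ children ⟨
    map (desLast p ∘ (x ∷_)) children
      ≡⟨ map-cong-local (All.tabulate (λ w∈ → desLast-∷-insertion p x r (proj₁ (∈-filter⁻ _ {xs = insertions N r} w∈)))) ⟩
    map (map₁ (k +_) ∘ desLast (just x)) children
      ≡⟨ List.map-∘ children ⟩
    map (map₁ (k +_)) (map (desLast (just x)) children)
      ≡⟨ cong (map (map₁ (k +_))) stats ⟩
    map (map₁ (k +_)) (map (flagged (des (x ∷ r)) (last r)) flags ++ [ des (x ∷ r) , just N ])
      ≡⟨ map-++ (map₁ (k +_)) (map (flagged (des (x ∷ r)) (last r)) flags) _ ⟩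
    map (map₁ (k +_)) (map (flagged (des (x ∷ r)) (last r)) flags) ++ [ k + des (x ∷ r) , just N ]
      ≡⟨ cong (_++ [ k + des (x ∷ r) , just N ]) shifted ⟩
    map (flagged (k + des (x ∷ r)) (last (x ∷ r))) flags ++ [ k + des (x ∷ r) , just N ]
      ≡⟨ cong (λ d → map (flagged d (last (x ∷ r))) flags ++ [ d , just N ]) (des-fromMaybe p x r) ⟨
    map (flagged (des (fromMaybe p ++ x ∷ r)) (last (x ∷ r))) flags ++ [ des (fromMaybe p ++ x ∷ r) , just N ] ∎
    where
    open ≡-Reasoning
    children : List (List ℕ)
    children = validInsertions N (just x) r
    flags : List Bool
    flags = insertionFlags (just x) r
    k : ℕ
    k = if descentInto p x then 1 else 0
    shifted : map (map₁ (k +_)) (map (flagged (des (x ∷ r)) (last r)) flags)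
              ≡ map (flagged (k + des (x ∷ r)) (last (x ∷ r))) flags
    shifted = begin
      map (map₁ (k +_)) (map (flagged (des (x ∷ r)) (last r)) flags)
        ≡⟨ List.map-∘ flags ⟨
      map (map₁ (k +_) ∘ flagged (des (x ∷ r)) (last r)) flags
        ≡⟨ List.map-cong (flagged-shift k (des (x ∷ r)) (last r)) flags ⟩
      map (flagged (k + des (x ∷ r)) (last r)) flags
        ≡⟨ flagged-last-∷ x r (k + des (x ∷ r)) ⟩
      map (flagged (k + des (x ∷ r)) (last (x ∷ r))) flags ∎

map-desLast-validInsertions : ∀ {N} p π → All (_< N) (fromMaybe p) → All (_< N) π → NoDoubleDescent (fromMaybe p ++ π) →
  map (desLast p) (validInsertions N p π)
    ≡ map (flagged (des (fromMaybe p ++ π)) (last π)) (insertionFlags p π) ++ [ des (fromMaybe p ++ π) , just N ]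
map-desLast-validInsertions nothing  [] _ _ _ = refl
map-desLast-validInsertions {N} (just y) [] (y<N ∷ []) _ _ rewrite dec-false (N <? y) (<⇒≯ y<N) = refl
map-desLast-validInsertions {N} p (x ∷ r) p<N (x<N ∷ r<N) ndd = begin
  map (desLast p) (filter V ([ N ∷ x ∷ r ] ++ map (x ∷_) (insertions N r)))
    ≡⟨ cong (map (desLast p)) (filter-++ V [ N ∷ x ∷ r ] (map (x ∷_) (insertions N r))) ⟩
  map (desLast p) (filter V [ N ∷ x ∷ r ] ++ filter V (map (x ∷_) (insertions N r)))
    ≡⟨ map-++ (desLast p) (filter V [ N ∷ x ∷ r ]) _ ⟩
  map (desLast p) (filter V [ N ∷ x ∷ r ]) ++ map (desLast p) (filter V (map (x ∷_) (insertions N r)))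
    ≡⟨ cong₂ _++_ (firstInsertion p x r p<N x<N ndd) (cong (map (desLast p)) (validInsertions-∷ p x r x<N ndd)) ⟩
  map F first ++ map (desLast p) (map (x ∷_) (validInsertions N (just x) r))
    ≡⟨ cong (map F first ++_) (desLast-∷-validInsertions p x r
         (map-desLast-validInsertions (just x) r (x<N ∷ []) r<N (NoDoubleDescent-fromMaybe⁻ p ndd))) ⟩
  map F first ++ (map F rest ++ [ D , just N ])
    ≡⟨ ++-assoc (map F first) (map F rest) _ ⟨
  (map F first ++ map F rest) ++ [ D , just N ]
    ≡⟨ cong (_++ [ D , just N ]) (map-++ F first rest) ⟨
  map F (first ++ rest) ++ [ D , just N ] ∎
  where
  open ≡-Reasoning
  V : (w : List ℕ) → Dec (NoDoubleDescent (fromMaybe p ++ w))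
  V w = noDoubleDescent? (fromMaybe p ++ w)
  D : ℕ
  D = des (fromMaybe p ++ x ∷ r)
  F : Bool → Stat
  F = flagged D (last (x ∷ r))
  first rest : List Bool
  first = if startsWithDescent (x ∷ r) then [] else [ descentInto p x ]
  rest  = insertionFlags (just x) r

ascLast : ℕ → List ℕ → Stat
ascLast n π = asc n π , last π

des-∷-≤ : ∀ x w → des (x ∷ w) ≤ length w
des-∷-≤ x []      = z≤n
des-∷-≤ x (y ∷ r) = +-mono-≤ (indicator≤1 (does (y <? x))) (des-∷-≤ y r)
  where
  indicator≤1 : ∀ s → (if s then 1 else 0) ≤ 1
  indicator≤1 true  = s≤s z≤n
  indicator≤1 false = z≤n

map-ascLast-simsunChildren : ∀ m {π} → π ∈ RS (suc m) →
  map (ascLast (suc (suc m))) (simsunChildren (suc m) π) ↭ offspring (suc m) (ascLast (suc m) π)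
map-ascLast-simsunChildren m {[]} π∈ with () ← proj₁ (proj₁ (∈-RS⁻ (suc m) π∈))
map-ascLast-simsunChildren m {π@(x ∷ xs)} π∈ with ∈-RS⁻ (suc m) π∈
... | (len , alph , _) , simsun = begin
  map (ascLast (suc (suc m))) (simsunChildren (suc m) π)
    ≡⟨ List.map-∘ (simsunChildren (suc m) π) ⟩
  map fromDes (map (desLast nothing) (validInsertions (suc (suc m)) nothing π))
    ≡⟨ cong (map fromDes) (map-desLast-validInsertions nothing π [] (All.map (s≤s ∘ proj₂) alph) ndd) ⟩
  map fromDes (map (flagged d l) flags ++ [ d , just (suc (suc m)) ])
    ≡⟨ List.map-++ fromDes (map (flagged d l) flags) _ ⟩
  map fromDes (map (flagged d l) flags) ∷ʳ (suc m ∸ d , just (suc (suc m)))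
    ↭⟨ ↭.∷↭∷ʳ _ _ ⟨
  (suc m ∸ d , just (suc (suc m))) ∷ map fromDes (map (flagged d l) flags)
    ≡⟨ cong₂ _∷_ (cong (_, just (suc (suc m))) suc[m∸d]) (trans (sym (List.map-∘ flags)) (List.map-cong fromDes-flagged flags)) ⟩
  (suc a , just (suc (suc m))) ∷ map (λ b → (if b then suc a else a) , l) flags
    ↭⟨ offspring-↭ (suc m) a l flags (trans (trues-insertionFlags nothing π ndd) (sym (m∸[m∸n]≡n d≤m)))
                   (trans (cong (length flags +_) (trues-insertionFlags nothing π ndd))
                     (trans (length-insertionFlags nothing π) len)) ⟩
  offspring (suc m) (a , l) ∎
  where
  open PermutationReasoning
  d a : ℕ
  d = des π
  a = m ∸ d
  l : Maybe ℕ
  l = last π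
  flags : List Bool
  flags = insertionFlags nothing π
  fromDes : Stat → Stat
  fromDes (k , l′) = suc m ∸ k , l′
  ndd : NoDoubleDescent π
  ndd = proj₂ (Simsun-suc⁻ m (All.map proj₂ alph) simsun)
  d≤m : d ≤ m
  d≤m = ≤-trans (des-∷-≤ x xs) (≤-reflexive (suc-injective len))
  suc[m∸d] : suc m ∸ d ≡ suc a
  suc[m∸d] = +-∸-assoc 1 d≤m
  fromDes-flagged : ∀ b → fromDes (flagged d l b) ≡ ((if b then suc a else a) , l)
  fromDes-flagged true  = cong (_, l) suc[m∸d]
  fromDes-flagged false = refl

ascLasts : ℕ → List Stat
ascLasts n = map (ascLast n) (RS n)

ascLasts-suc : ∀ m → ascLasts (suc (suc m)) ↭ concatMap (offspring (suc m)) (ascLasts (suc m))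
ascLasts-suc m =
  ↭-trans (↭.map⁺ (ascLast (suc (suc m))) (RS-suc-↭ (suc m)))
          (map-concatMap-↭ (ascLast (suc (suc m))) (ascLast (suc m)) (simsunChildren (suc m)) (offspring (suc m)) (RS (suc m))
                           (map-ascLast-simsunChildren m))

-- Inversion sequences avoiding 000

occ : ℕ → List ℕ → ℕ
occ v = countBy (v ≟_)

occ-here : ∀ y e → occ y (y ∷ e) ≡ suc (occ y e)
occ-here y e = cong length (filter-accept (y ≟_) refl)

occ-there : ∀ {v y} e → v ≢ y → occ v (y ∷ e) ≡ occ v e
occ-there {v} e v≢y = cong length (filter-reject (v ≟_) v≢y)

occ-≤-∷ : ∀ v y e → occ v e ≤ occ v (y ∷ e)
occ-≤-∷ v y e with v ≟ y
... | yes refl = subst (occ v e ≤_) (sym (occ-here v e)) (n≤1+n _)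
... | no  v≢y  = subst (occ v e ≤_) (sym (occ-there e v≢y)) ≤-refl

∈⇒1≤occ : ∀ {v e} → v ∈ e → 1 ≤ occ v e
∈⇒1≤occ {v} = filter-some (v ≟_)

∉⇒occ≡0 : ∀ {v e} → v ∉ e → occ v e ≡ 0
∉⇒occ≡0 {v} {e} v∉e = cong length (filter-none (v ≟_) (All.tabulate λ z∈ v≡z → v∉e (subst (_∈ e) (sym v≡z) z∈)))

1≤occ⇒∈ : ∀ {v} e → 1 ≤ occ v e → v ∈ e
1≤occ⇒∈ {v} e 1≤occ with v ∈? e
... | yes v∈e = v∈e
... | no  v∉e with () ← subst (1 ≤_) (∉⇒occ≡0 v∉e) 1≤occ

RepeatedPair : ℕ → List ℕ → Set
RepeatedPair y e = ∃₂ λ (j k : Fin (length e)) → toℕ j < toℕ k × lookup e j ≡ y × lookup e k ≡ y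

RepeatedPair⇒2≤occ : ∀ {y} e → RepeatedPair y e → 2 ≤ occ y e
RepeatedPair⇒2≤occ {y} (x ∷ e) (zero , suc k , _ , refl , ek≡y) =
  subst (2 ≤_) (sym (occ-here y e)) (s≤s (∈⇒1≤occ (subst (_∈ e) ek≡y (∈-lookup k))))
RepeatedPair⇒2≤occ {y} (x ∷ e) (suc j , suc k , s≤s j<k , ej≡y , ek≡y) =
  ≤-trans (RepeatedPair⇒2≤occ e (j , k , j<k , ej≡y , ek≡y)) (occ-≤-∷ y x e)

2≤occ⇒RepeatedPair : ∀ {y} e → 2 ≤ occ y e → RepeatedPair y e
2≤occ⇒RepeatedPair {y} (x ∷ e) 2≤occ with y ≟ x
... | yes refl =
  let y∈e = 1≤occ⇒∈ e (≤-pred (subst (2 ≤_) (occ-here y e) 2≤occ))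
  in zero , suc (index y∈e) , s≤s z≤n , refl , sym (lookup-index y∈e)
... | no y≢x with 2≤occ⇒RepeatedPair e (subst (2 ≤_) (occ-there e y≢x) 2≤occ)
...   | j , k , j<k , ej≡y , ek≡y = suc j , suc k , s≤s j<k , ej≡y , ek≡y

Avoids000-∷ : ∀ y e → Avoids000 (y ∷ e) ⇔ (Avoids000 e × occ y e ≤ 1)
Avoids000-∷ y e = mk⇔ to from
  where
  to : Avoids000 (y ∷ e) → Avoids000 e × occ y e ≤ 1
  to avoids = (λ i j k i<j j<k → avoids (suc i) (suc j) (suc k) (s≤s i<j) (s≤s j<k)) , occ≤1
    where
    occ≤1 : occ y e ≤ 1
    occ≤1 with occ y e ≤? 1
    ... | yes ≤1 = ≤1
    ... | no  ≰1 with 2≤occ⇒RepeatedPair e (≰⇒> ≰1)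
    ...   | j , k , j<k , ej≡y , ek≡y =
      ⊥-elim (avoids zero (suc j) (suc k) (s≤s z≤n) (s≤s j<k) (sym ej≡y , trans ej≡y (sym ek≡y)))
  from : Avoids000 e × occ y e ≤ 1 → Avoids000 (y ∷ e)
  from (avoids , occ≤1) zero (suc j) (suc k) _ (s≤s j<k) (y≡ej , ej≡ek) =
    <-irrefl refl (≤-trans (RepeatedPair⇒2≤occ e (j , k , j<k , sym y≡ej , trans (sym ej≡ek) (sym y≡ej))) occ≤1)
  from (avoids , _) (suc i) (suc j) (suc k) (s≤s i<j) (s≤s j<k) = avoids i j k i<j j<k

AtMostTwice : List ℕ → Set
AtMostTwice e = ∀ v → occ v e ≤ 2

AtMostTwice-∷ : ∀ y e → AtMostTwice (y ∷ e) ⇔ (AtMostTwice e × occ y e ≤ 1)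
AtMostTwice-∷ y e = mk⇔
  (λ twice → (λ v → ≤-trans (occ-≤-∷ v y e) (twice v)) , ≤-pred (subst (_≤ 2) (occ-here y e) (twice y)))
  (λ (twice , occ≤1) v → bound twice occ≤1 v)
  where
  bound : AtMostTwice e → occ y e ≤ 1 → AtMostTwice (y ∷ e)
  bound twice occ≤1 v with v ≟ y
  ... | yes refl = subst (_≤ 2) (sym (occ-here y e)) (s≤s occ≤1)
  ... | no  v≢y  = subst (_≤ 2) (sym (occ-there e v≢y)) (twice v)

Avoids000⇔AtMostTwice : ∀ e → Avoids000 e ⇔ AtMostTwice e
Avoids000⇔AtMostTwice []      = mk⇔ (λ _ _ → z≤n) (λ _ ())
Avoids000⇔AtMostTwice (y ∷ e) =
  ⇔-sym (AtMostTwice-∷ y e) ⇔-∘ ((Avoids000⇔AtMostTwice e ×-⇔ ⇔-id _) ⇔-∘ Avoids000-∷ y e)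

AtMostTwice-↭ : ∀ {e e′} → e ↭ e′ → AtMostTwice e → AtMostTwice e′
AtMostTwice-↭ e↭e′ twice v = subst (_≤ 2) (countBy-↭ (v ≟_) e↭e′) (twice v)

dropLast : List ℕ → List ℕ
dropLast []          = []
dropLast (_ ∷ [])    = []
dropLast (x ∷ y ∷ e) = x ∷ dropLast (y ∷ e)

dropLast-∷ʳ : ∀ e x → dropLast (e ++ [ x ]) ≡ e
dropLast-∷ʳ []          x = refl
dropLast-∷ʳ (y ∷ [])    x = refl
dropLast-∷ʳ (y ∷ z ∷ e) x = cong (y ∷_) (dropLast-∷ʳ (z ∷ e) x)

last-∷ʳ : ∀ (e : List ℕ) x → last (e ++ [ x ]) ≡ just x
last-∷ʳ []          x = refl
last-∷ʳ (y ∷ [])    x = refl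
last-∷ʳ (y ∷ z ∷ e) x = last-∷ʳ (z ∷ e) x

∈-invSeqs⁻ : ∀ n {e} → e ∈ invSeqs (suc n) → ∃₂ λ e′ x → e′ ∈ invSeqs n × x < suc n × e ≡ e′ ++ [ x ]
∈-invSeqs⁻ n e∈ with ∈-concatMap⁻′ (λ e → map (λ x → e ++ [ x ]) (upTo (suc n))) (invSeqs n) e∈
... | e′ , e′∈ , e∈map with ∈-map⁻ (λ x → e′ ++ [ x ]) e∈map
... | x , x∈ , refl = e′ , x , e′∈ , ∈-upTo⁻ x∈ , refl

∈-invSeqs⁺ : ∀ n {e x} → e ∈ invSeqs n → x < suc n → e ++ [ x ] ∈ invSeqs (suc n)
∈-invSeqs⁺ n {e} e∈ x<n+1 =
  ∈-concatMap⁺′ (λ e → map (λ x → e ++ [ x ]) (upTo (suc n))) e∈ (∈-map⁺ (λ x → e ++ [ x ]) (∈-upTo⁺ x<n+1))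

Unique-invSeqs : ∀ n → Unique (invSeqs n)
Unique-invSeqs zero    = [] ∷ []
Unique-invSeqs (suc n) = Unique-concatMap⁺ (λ e → map (λ x → e ++ [ x ]) (upTo (suc n))) dropLast (Unique-invSeqs n)
  (λ {e} _ → Unique.map⁺ (λ eq → ∷-injectiveˡ (++-cancelˡ e _ _ eq)) (Unique.upTo⁺ (suc n)))
  (λ {e} _ w∈ → let _ , _ , w≡ = ∈-map⁻ (λ x → e ++ [ x ]) w∈ in trans (cong dropLast w≡) (dropLast-∷ʳ e _))

length-∈-invSeqs : ∀ n {e} → e ∈ invSeqs n → length e ≡ n
length-∈-invSeqs zero    (here refl) = refl
length-∈-invSeqs (suc n) e∈ with ∈-invSeqs⁻ n e∈
... | e′ , x , e′∈ , _ , refl = trans (length-++ e′) (trans (+-comm (length e′) 1) (cong suc (length-∈-invSeqs n e′∈)))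

All<-∈-invSeqs : ∀ n {e} → e ∈ invSeqs n → All (_< n) e
All<-∈-invSeqs zero    (here refl) = []
All<-∈-invSeqs (suc n) e∈ with ∈-invSeqs⁻ n e∈
... | e′ , x , e′∈ , x<n+1 , refl = All.++⁺ (All.map m≤n⇒m≤1+n (All<-∈-invSeqs n e′∈)) (x<n+1 ∷ [])

0∈-invSeqs : ∀ n {e} → e ∈ invSeqs (suc n) → 0 ∈ e
0∈-invSeqs zero    e∈ with ∈-invSeqs⁻ zero e∈
... | [] , zero , here refl , _ , refl = here refl
... | [] , suc _ , here refl , s≤s () , _
0∈-invSeqs (suc n) e∈ with ∈-invSeqs⁻ (suc n) e∈
... | e′ , x , e′∈ , _ , refl = ∈-++⁺ˡ (0∈-invSeqs n e′∈)

∈-I000⁻ : ∀ n {e} → e ∈ I000 n → e ∈ invSeqs n × AtMostTwice e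
∈-I000⁻ n {e} e∈ = let e∈inv , avoids = ∈-filter⁻ avoids000? {xs = invSeqs n} e∈
                   in e∈inv , Equivalence.to (Avoids000⇔AtMostTwice e) avoids

∈-I000⁺ : ∀ n {e} → e ∈ invSeqs n → AtMostTwice e → e ∈ I000 n
∈-I000⁺ n {e} e∈ twice = ∈-filter⁺ avoids000? e∈ (Equivalence.from (Avoids000⇔AtMostTwice e) twice)

Unique-I000 : ∀ n → Unique (I000 n)
Unique-I000 n = Unique.filter⁺ avoids000? (Unique-invSeqs n)

insertBeforeLast : ℕ → List ℕ → List ℕ
insertBeforeLast y e = dropLast e ++ y ∷ fromMaybe (last e)

insertBeforeLast-∷ʳ : ∀ y e x → insertBeforeLast y (e ++ [ x ]) ≡ (e ++ [ y ]) ++ [ x ]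
insertBeforeLast-∷ʳ y e x rewrite dropLast-∷ʳ e x | last-∷ʳ e x = sym (++-assoc e [ y ] [ x ])

atMostOnce? : (e : List ℕ) → Decidable (λ y → occ y e ≤ 1)
atMostOnce? e y = occ y e ≤? 1

inversionChildren : ℕ → List ℕ → List (List ℕ)
inversionChildren M e = (e ++ [ M ]) ∷ map (λ y → insertBeforeLast y e) (filter (atMostOnce? e) (upTo M))

inversionParent : ℕ → List ℕ → List ℕ
inversionParent M w = parentWithLast (last w)
  where
  parentWithLast : Maybe ℕ → List ℕ
  parentWithLast nothing  = w
  parentWithLast (just x) = if does (x ≟ M) then dropLast w else dropLast (dropLast w) ++ [ x ]

inversionParent-∷ʳ-max : ∀ M e → inversionParent M (e ++ [ M ]) ≡ e
inversionParent-∷ʳ-max M e rewrite last-∷ʳ e M | dec-true (M ≟ M) refl = dropLast-∷ʳ e M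

inversionParent-∷ʳ : ∀ M e x → x ≢ M → inversionParent M (e ++ [ x ]) ≡ dropLast e ++ [ x ]
inversionParent-∷ʳ M e x x≢M rewrite last-∷ʳ e x | dec-false (x ≟ M) x≢M | dropLast-∷ʳ e x = refl

∷ʳ-∷ʳ↭∷-∷ʳ : ∀ y (e : List ℕ) x → (e ++ [ y ]) ++ [ x ] ↭ y ∷ e ++ [ x ]
∷ʳ-∷ʳ↭∷-∷ʳ y e x = ↭-trans (↭-reflexive (++-assoc e [ y ] [ x ])) (↭.shift y e [ x ])

∈-I000-suc⁻ : ∀ m {e} → e ∈ I000 (suc m) → ∃₂ λ i x → i ∈ invSeqs m × x < suc m × e ≡ i ++ [ x ]
∈-I000-suc⁻ m e∈ = ∈-invSeqs⁻ m (proj₁ (∈-I000⁻ (suc m) e∈))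

max∉invSeq : ∀ {n e} → e ∈ invSeqs n → n ∉ e
max∉invSeq {n} e∈ n∈e = <-irrefl refl (All.lookup (All<-∈-invSeqs n e∈) n∈e)

Unique-inversionChildren : ∀ m {e} → e ∈ I000 (suc m) → Unique (inversionChildren (suc m) e)
Unique-inversionChildren m e∈ with ∈-I000-suc⁻ m e∈
... | i , x , _ , x<M , refl =
  All.tabulate max≢ ∷ Unique.map⁺ insert-injective (Unique.filter⁺ (atMostOnce? (i ++ [ x ])) (Unique.upTo⁺ (suc m)))
  where
  lastOfDropLast : ∀ y → last (dropLast (insertBeforeLast y (i ++ [ x ]))) ≡ just y
  lastOfDropLast y = trans (cong (last ∘ dropLast) (insertBeforeLast-∷ʳ y i x))
                           (trans (cong last (dropLast-∷ʳ (i ++ [ y ]) x)) (last-∷ʳ i y))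
  insert-injective : ∀ {y y′} → insertBeforeLast y (i ++ [ x ]) ≡ insertBeforeLast y′ (i ++ [ x ]) → y ≡ y′
  insert-injective {y} {y′} eq =
    just-injective (trans (sym (lastOfDropLast y)) (trans (cong (last ∘ dropLast) eq) (lastOfDropLast y′)))
  max≢ : ∀ {w} → w ∈ map (λ y → insertBeforeLast y (i ++ [ x ])) (filter (atMostOnce? (i ++ [ x ])) (upTo (suc m))) →
    (i ++ [ x ]) ++ [ suc m ] ≢ w
  max≢ w∈ eq with ∈-map⁻ (λ y → insertBeforeLast y (i ++ [ x ])) w∈
  ... | y , _ , refl = <⇒≢ x<M (just-injective (begin
      just x                            ≡⟨ last-∷ʳ (i ++ [ y ]) x ⟨
      last ((i ++ [ y ]) ++ [ x ])      ≡⟨ cong last (trans eq (insertBeforeLast-∷ʳ y i x)) ⟨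
      last ((i ++ [ x ]) ++ [ suc m ])  ≡⟨ last-∷ʳ (i ++ [ x ]) (suc m) ⟩
      just (suc m)                      ∎))
    where open ≡-Reasoning

inversionParent-∈-inversionChildren : ∀ m {e w} → e ∈ I000 (suc m) → w ∈ inversionChildren (suc m) e →
  inversionParent (suc m) w ≡ e
inversionParent-∈-inversionChildren m {e} _ (here refl) = inversionParent-∷ʳ-max (suc m) e
inversionParent-∈-inversionChildren m e∈ (there w∈) with ∈-I000-suc⁻ m e∈
... | i , x , _ , x<M , refl with ∈-map⁻ (λ y → insertBeforeLast y (i ++ [ x ])) w∈
...   | y , _ , refl = begin
  inversionParent (suc m) (insertBeforeLast y (i ++ [ x ]))  ≡⟨ cong (inversionParent (suc m)) (insertBeforeLast-∷ʳ y i x) ⟩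
  inversionParent (suc m) ((i ++ [ y ]) ++ [ x ])            ≡⟨ inversionParent-∷ʳ (suc m) (i ++ [ y ]) x (<⇒≢ x<M) ⟩
  dropLast (i ++ [ y ]) ++ [ x ]                             ≡⟨ cong (_++ [ x ]) (dropLast-∷ʳ i y) ⟩
  i ++ [ x ]                                                 ∎
  where open ≡-Reasoning

I000-suc⊆children : ∀ m {w} → w ∈ I000 (suc (suc m)) → w ∈ concatMap (inversionChildren (suc m)) (I000 (suc m))
I000-suc⊆children m w∈ with ∈-I000⁻ (suc (suc m)) w∈
... | w∈inv , twice with ∈-invSeqs⁻ (suc m) w∈inv
... | e , x , e∈ , x<M+1 , refl with x ≟ suc m
...   | yes refl = ∈-concatMap⁺′ (inversionChildren (suc m)) (∈-I000⁺ (suc m) e∈ twiceE) (here refl)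
  where
  twiceE : AtMostTwice e
  twiceE = proj₁ (Equivalence.to (AtMostTwice-∷ (suc m) e) (AtMostTwice-↭ (↭-sym (↭.∷↭∷ʳ (suc m) e)) twice))
...   | no x≢M with ∈-invSeqs⁻ m e∈
...     | i , y , i∈ , y<M , refl =
  ∈-concatMap⁺′ (inversionChildren (suc m)) (∈-I000⁺ (suc m) (∈-invSeqs⁺ m i∈ x<M) (proj₁ twiceYP))
    (there (subst (_∈ _) (insertBeforeLast-∷ʳ y i x)
             (∈-map⁺ (λ y → insertBeforeLast y (i ++ [ x ]))
                     (∈-filter⁺ (atMostOnce? (i ++ [ x ])) (∈-upTo⁺ y<M) (proj₂ twiceYP)))))
  where
  x<M : x < suc m
  x<M = ≤∧≢⇒< (≤-pred x<M+1) x≢M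
  twiceYP : AtMostTwice (i ++ [ x ]) × occ y (i ++ [ x ]) ≤ 1
  twiceYP = Equivalence.to (AtMostTwice-∷ y (i ++ [ x ])) (AtMostTwice-↭ (∷ʳ-∷ʳ↭∷-∷ʳ y i x) twice)

children⊆I000-suc : ∀ m {w} → w ∈ concatMap (inversionChildren (suc m)) (I000 (suc m)) → w ∈ I000 (suc (suc m))
children⊆I000-suc m w∈ with ∈-concatMap⁻′ (inversionChildren (suc m)) (I000 (suc m)) w∈
... | e , e∈ , here refl with ∈-I000⁻ (suc m) e∈
...   | e∈inv , twice =
  ∈-I000⁺ (suc (suc m)) (∈-invSeqs⁺ (suc m) e∈inv ≤-refl)
    (AtMostTwice-↭ (↭.∷↭∷ʳ (suc m) e) (Equivalence.from (AtMostTwice-∷ (suc m) e)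
      (twice , subst (_≤ 1) (sym (∉⇒occ≡0 (max∉invSeq e∈inv))) z≤n)))
children⊆I000-suc m w∈ | e , e∈ , there c∈ with ∈-I000-suc⁻ m e∈ | ∈-I000⁻ (suc m) e∈
... | i , x , i∈ , x<M , refl | _ , twice with ∈-map⁻ (λ y → insertBeforeLast y (i ++ [ x ])) c∈
...   | y , y∈valid , refl with ∈-filter⁻ (atMostOnce? (i ++ [ x ])) {xs = upTo (suc m)} y∈valid
...     | y∈ , occ≤1 =
  subst (_∈ I000 (suc (suc m))) (sym (insertBeforeLast-∷ʳ y i x))
    (∈-I000⁺ (suc (suc m)) (∈-invSeqs⁺ (suc m) (∈-invSeqs⁺ m i∈ (∈-upTo⁻ y∈)) (m≤n⇒m≤1+n x<M))
      (AtMostTwice-↭ (↭-sym (∷ʳ-∷ʳ↭∷-∷ʳ y i x)) (Equivalence.from (AtMostTwice-∷ y (i ++ [ x ])) (twice , occ≤1))))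

I000-suc-↭ : ∀ m → I000 (suc (suc m)) ↭ concatMap (inversionChildren (suc m)) (I000 (suc m))
I000-suc-↭ m = unique∧sameElements⇒↭ (Unique-I000 (suc (suc m)))
  (Unique-concatMap⁺ (inversionChildren (suc m)) (inversionParent (suc m)) (Unique-I000 (suc m))
    (Unique-inversionChildren m) (inversionParent-∈-inversionChildren m))
  (mk⇔ (I000-suc⊆children m) (children⊆I000-suc m))

-- Distinct positive entries

∈-positives : ∀ {v} e → v ∈ deduplicate _≟_ (filter (0 <?_) e) ⇔ (0 < v × v ∈ e)
∈-positives e = mk⇔
  (λ v∈ → let v∈e , pos = ∈-filter⁻ (0 <?_) (∈-deduplicate⁻ _≟_ (filter (0 <?_) e) v∈) in pos , v∈e)
  (λ (pos , v∈e) → ∈-deduplicate⁺ _≟_ (∈-filter⁺ (0 <?_) v∈e pos))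

dist-sameElements : ∀ {e e′} → (∀ {v} → v ∈ e ⇔ v ∈ e′) → dist e ≡ dist e′
dist-sameElements {e} {e′} e⇔e′ = ↭-length (unique∧sameElements⇒↭ (deduplicate-! _) (deduplicate-! _)
  (mk⇔ (λ v∈ → let pos , v∈e = Equivalence.to (∈-positives e) v∈
               in Equivalence.from (∈-positives e′) (pos , Equivalence.to e⇔e′ v∈e))
       (λ v∈ → let pos , v∈e′ = Equivalence.to (∈-positives e′) v∈
               in Equivalence.from (∈-positives e) (pos , Equivalence.from e⇔e′ v∈e′))))

dist-↭ : ∀ {e e′} → e ↭ e′ → dist e ≡ dist e′
dist-↭ e↭e′ = dist-sameElements (mk⇔ (∈-resp-↭ e↭e′) (∈-resp-↭ (↭-sym e↭e′)))

dist-∷-∈ : ∀ {y e} → y ∈ e → dist (y ∷ e) ≡ dist e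
dist-∷-∈ y∈e = dist-sameElements (mk⇔ (λ { (here refl) → y∈e ; (there v∈) → v∈ }) there)

dist-∷-∉ : ∀ {y e} → 0 < y → y ∉ e → dist (y ∷ e) ≡ suc (dist e)
dist-∷-∉ {y} {e} pos y∉e rewrite filter-accept (0 <?_) {xs = e} pos =
  cong suc (cong length (filter-all (¬? ∘ (y ≟_)) (All.tabulate λ v∈ y≡v →
    y∉e (subst (_∈ e) (sym y≡v) (proj₂ (Equivalence.to (∈-positives e) v∈))))))

present≡suc-dist : ∀ B {e} → 0 ∈ e → All (_< B) e → countBy (_∈? e) (upTo B) ≡ suc (dist e)
present≡suc-dist B {e} 0∈e e<B = trans (sym (↭-length dedup↭present)) (↭-length dedup↭0∷positives)
  where
  dedup↭present : deduplicate _≟_ e ↭ filter (_∈? e) (upTo B)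
  dedup↭present = unique∧sameElements⇒↭ (deduplicate-! e) (Unique.filter⁺ (_∈? e) (Unique.upTo⁺ B))
    (mk⇔ (λ v∈ → let v∈e = ∈-deduplicate⁻ _≟_ e v∈ in ∈-filter⁺ (_∈? e) (∈-upTo⁺ (All.lookup e<B v∈e)) v∈e)
         (λ v∈ → ∈-deduplicate⁺ _≟_ (proj₂ (∈-filter⁻ (_∈? e) {xs = upTo B} v∈))))
  dedup↭0∷positives : deduplicate _≟_ e ↭ 0 ∷ deduplicate _≟_ (filter (0 <?_) e)
  dedup↭0∷positives = unique∧sameElements⇒↭ (deduplicate-! e)
    (All.tabulate (λ v∈ 0≡v → <-irrefl 0≡v (proj₁ (Equivalence.to (∈-positives e) v∈))) ∷ deduplicate-! _)
    (mk⇔ (λ v∈ → positiveOrZero (∈-deduplicate⁻ _≟_ e v∈))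
         (λ { (here refl) → ∈-deduplicate⁺ _≟_ 0∈e
            ; (there v∈) → ∈-deduplicate⁺ _≟_ (proj₂ (Equivalence.to (∈-positives e) v∈)) }))
    where
    positiveOrZero : ∀ {v} → v ∈ e → v ∈ 0 ∷ deduplicate _≟_ (filter (0 <?_) e)
    positiveOrZero {zero}  _   = here refl
    positiveOrZero {suc v} v∈e = there (Equivalence.from (∈-positives e) (s≤s z≤n , v∈e))

private
  2≤-cong : ∀ {m n} → m ≡ n → 2 ≤ m ⇔ 2 ≤ n
  2≤-cong refl = mk⇔ (λ p → p) (λ p → p)

present+repeated≡length : ∀ B {e} → All (_< B) e → AtMostTwice e →
  countBy (_∈? e) (upTo B) + countBy (λ v → 2 ≤? occ v e) (upTo B) ≡ length e
present+repeated≡length B {[]} _ _ =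
  cong₂ _+_ (cong length (filter-none (_∈? []) {xs = upTo B} (All.tabulate λ _ ())))
            (cong length (filter-none (λ v → 2 ≤? occ v []) {xs = upTo B} (All.tabulate λ _ ())))
present+repeated≡length B {x ∷ e} (x<B ∷ e<B) twice with Equivalence.to (AtMostTwice-∷ x e) twice
... | twiceE , occ≤1 with x ∈? e
...   | yes x∈e = begin
  countBy (_∈? (x ∷ e)) (upTo B) + countBy (λ v → 2 ≤? occ v (x ∷ e)) (upTo B)
    ≡⟨ cong₂ _+_ (countBy-cong-∈ _ _ (upTo B) (λ _ → mk⇔ (λ { (here refl) → x∈e ; (there v∈) → v∈ }) there))
                 (countBy-point (λ v → 2 ≤? occ v e) _ (Unique.upTo⁺ B) (∈-upTo⁺ x<B)
                    (λ 2≤occ → <-irrefl refl (≤-trans 2≤occ occ≤1))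
                    (subst (2 ≤_) (sym (occ-here x e)) (s≤s (∈⇒1≤occ x∈e)))
                    (λ _ v≢x → 2≤-cong (sym (occ-there e v≢x)))) ⟩
  countBy (_∈? e) (upTo B) + suc (countBy (λ v → 2 ≤? occ v e) (upTo B))
    ≡⟨ +-suc _ _ ⟩
  suc (countBy (_∈? e) (upTo B) + countBy (λ v → 2 ≤? occ v e) (upTo B))
    ≡⟨ cong suc (present+repeated≡length B e<B twiceE) ⟩
  suc (length e) ∎
  where open ≡-Reasoning
...   | no x∉e =
  trans (cong₂ _+_ (countBy-point (_∈? e) (_∈? (x ∷ e)) (Unique.upTo⁺ B) (∈-upTo⁺ x<B) x∉e (here refl)
                      (λ _ v≢x → mk⇔ there λ { (here refl) → ⊥-elim (v≢x refl) ; (there v∈) → v∈ }))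
                   (countBy-cong-∈ _ _ (upTo B) (λ {v} _ → unchanged v)))
        (cong suc (present+repeated≡length B e<B twiceE))
  where
  unchanged : ∀ v → 2 ≤ occ v (x ∷ e) ⇔ 2 ≤ occ v e
  unchanged v with v ≟ x
  ... | no  v≢x  = 2≤-cong (occ-there e v≢x)
  ... | yes refl rewrite occ-here x e | ∉⇒occ≡0 x∉e = mk⇔ (λ { (s≤s ()) }) (λ ())

absent≡m∸dist : ∀ m {e} → e ∈ I000 (suc m) → countBy (¬? ∘ (_∈? e)) (upTo (suc m)) ≡ m ∸ dist e
absent≡m∸dist m {e} e∈ = begin
  absent                     ≡⟨ sym (m+n∸m≡n (dist e) absent) ⟩
  dist e + absent ∸ dist e   ≡⟨ cong (_∸ dist e) (suc-injective present+absent) ⟩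
  m ∸ dist e                 ∎
  where
  open ≡-Reasoning
  e∈inv : e ∈ invSeqs (suc m)
  e∈inv = proj₁ (∈-I000⁻ (suc m) e∈)
  absent : ℕ
  absent = countBy (¬? ∘ (_∈? e)) (upTo (suc m))
  present+absent : suc (dist e) + absent ≡ suc m
  present+absent = begin
    suc (dist e) + absent                             ≡⟨ cong (_+ absent) present≡ ⟨
    countBy (_∈? e) (upTo (suc m)) + absent           ≡⟨ countBy+countBy¬≡length (_∈? e) (upTo (suc m)) ⟩
    length (upTo (suc m))                             ≡⟨ length-upTo (suc m) ⟩
    suc m                                             ∎
    where
    present≡ : countBy (_∈? e) (upTo (suc m)) ≡ suc (dist e)
    present≡ = present≡suc-dist (suc m) (0∈-invSeqs m e∈inv) (All<-∈-invSeqs (suc m) e∈inv)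

valid+absent≡suc : ∀ m {e} → e ∈ I000 (suc m) →
  countBy (atMostOnce? e) (upTo (suc m)) + countBy (¬? ∘ (_∈? e)) (upTo (suc m)) ≡ suc m
valid+absent≡suc m {e} e∈ = begin
  valid + absent    ≡⟨ cong (valid +_) absent≡repeated ⟩
  valid + repeated  ≡⟨ cong (_+ repeated) (countBy-cong-∈ (atMostOnce? e) (¬? ∘ twice?) (upTo M) (λ _ → ≤1⇔≱2)) ⟩
  countBy (¬? ∘ twice?) (upTo M) + repeated  ≡⟨ +-comm _ repeated ⟩
  repeated + countBy (¬? ∘ twice?) (upTo M)  ≡⟨ countBy+countBy¬≡length twice? (upTo M) ⟩
  length (upTo M)                            ≡⟨ length-upTo M ⟩
  M                                          ∎
  where
  open ≡-Reasoning
  M : ℕ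
  M = suc m
  e∈inv : e ∈ invSeqs M
  e∈inv = proj₁ (∈-I000⁻ M e∈)
  twice? : Decidable (λ y → 2 ≤ occ y e)
  twice? y = 2 ≤? occ y e
  valid absent present repeated : ℕ
  valid = countBy (atMostOnce? e) (upTo M)
  absent = countBy (¬? ∘ (_∈? e)) (upTo M)
  present = countBy (_∈? e) (upTo M)
  repeated = countBy twice? (upTo M)
  -- e has as many entries as there are possible values, so as many values are missing as repeated.
  absent≡repeated : absent ≡ repeated
  absent≡repeated = +-cancelˡ-≡ present absent repeated (begin
    present + absent   ≡⟨ trans (countBy+countBy¬≡length (_∈? e) (upTo M)) (length-upTo M) ⟩
    M                  ≡⟨ sym (length-∈-invSeqs M e∈inv) ⟩
    length e           ≡⟨ sym (present+repeated≡length M (All<-∈-invSeqs M e∈inv) (proj₂ (∈-I000⁻ M e∈))) ⟩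
    present + repeated ∎)
  ≤1⇔≱2 : ∀ {y} → occ y e ≤ 1 ⇔ (¬ 2 ≤ occ y e)
  ≤1⇔≱2 = mk⇔ (λ ≤1 ≥2 → <-irrefl refl (≤-trans ≥2 ≤1)) (λ ≱2 → ≤-pred (≰⇒> ≱2))

distLast : List ℕ → Stat
distLast e = dist e , Maybe.map suc (last e)

dist-∷ : ∀ y e → 0 ∈ e → dist (y ∷ e) ≡ (if does (¬? (y ∈? e)) then suc (dist e) else dist e)
dist-∷ y e 0∈e with y ∈? e
... | yes y∈e = dist-∷-∈ y∈e
... | no  y∉e = dist-∷-∉ (n≢0⇒n>0 λ { refl → y∉e 0∈e }) y∉e

map-distLast-inversionChildren : ∀ m {e} → e ∈ I000 (suc m) →
  map distLast (inversionChildren (suc m) e) ↭ offspring (suc m) (distLast e)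
map-distLast-inversionChildren m {e} e∈ with ∈-I000-suc⁻ m e∈
... | i , x , _ , _ , refl = begin
  map distLast (inversionChildren M e)
    ≡⟨ cong₂ _∷_ maxChild (trans (sym (List.map-∘ valid)) (trans (List.map-cong insertedChild valid) (List.map-∘ valid))) ⟩
  (suc a , just (suc M)) ∷ map (λ b → (if b then suc a else a) , l) flags
    ↭⟨ offspring-↭ M a l flags trues≡ (trans (cong₂ _+_ (List.length-map _ valid) trues≡absent) (valid+absent≡suc m e∈)) ⟩
  offspring M (a , l) ∎
  where
  open PermutationReasoning
  M a : ℕ
  M = suc m
  a = dist e
  l : Maybe ℕ
  l = Maybe.map suc (last e)
  e∈inv : e ∈ invSeqs M
  e∈inv = proj₁ (∈-I000⁻ M e∈)
  valid : List ℕ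
  valid = filter (atMostOnce? e) (upTo M)
  flags : List Bool
  flags = map (does ∘ ¬? ∘ (_∈? e)) valid
  maxChild : distLast (e ++ [ M ]) ≡ (suc a , just (suc M))
  maxChild = cong₂ _,_ (trans (dist-↭ (↭-sym (↭.∷↭∷ʳ M e))) (dist-∷-∉ (s≤s z≤n) (max∉invSeq e∈inv)))
                       (cong (Maybe.map suc) (last-∷ʳ e M))
  insertedChild : ∀ y → distLast (insertBeforeLast y e) ≡ ((if does (¬? (y ∈? e)) then suc a else a) , l)
  insertedChild y = cong₂ _,_
    (trans (cong dist (insertBeforeLast-∷ʳ y i x)) (trans (dist-↭ (∷ʳ-∷ʳ↭∷-∷ʳ y i x)) (dist-∷ y e (0∈-invSeqs m e∈inv))))
    (cong (Maybe.map suc) (trans (cong last (insertBeforeLast-∷ʳ y i x)) (trans (last-∷ʳ (i ++ [ y ]) x) (sym (last-∷ʳ i x)))))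
  trues≡absent : countBy T? flags ≡ countBy (¬? ∘ (_∈? e)) (upTo M)
  trues≡absent = trans (countBy-T?-does (¬? ∘ (_∈? e)) valid)
    (countBy-filter-⊆ (¬? ∘ (_∈? e)) (atMostOnce? e) (upTo M) (λ y∉e → subst (_≤ 1) (sym (∉⇒occ≡0 y∉e)) z≤n))
  trues≡ : countBy T? flags ≡ m ∸ a
  trues≡ = trans trues≡absent (absent≡m∸dist m e∈)

distLasts : ℕ → List Stat
distLasts n = map distLast (I000 n)

distLasts-suc : ∀ m → distLasts (suc (suc m)) ↭ concatMap (offspring (suc m)) (distLasts (suc m))
distLasts-suc m =
  ↭-trans (↭.map⁺ distLast (I000-suc-↭ m))
          (map-concatMap-↭ distLast distLast (inversionChildren (suc m)) (offspring (suc m)) (I000 (suc m))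
                           (map-distLast-inversionChildren m))

ascLasts↭distLasts : ∀ m → ascLasts (suc m) ↭ distLasts (suc m)
ascLasts↭distLasts = ↭-fromRecursion offspring ascLasts distLasts ↭-refl ascLasts-suc distLasts-suc

theorem5p1 : (n : ℕ) → 1 ≤ n → (a b : ℕ) → coeffLHS n a b ≡ coeffRHS n a b
theorem5p1 (suc m) _ a b = begin
  coeffLHS (suc m) a b                       ≡⟨ countBy-map isCoefficient (ascLast (suc m)) (RS (suc m)) ⟨
  countBy isCoefficient (ascLasts (suc m))   ≡⟨ countBy-↭ isCoefficient (ascLasts↭distLasts m) ⟩
  countBy isCoefficient (distLasts (suc m))  ≡⟨ countBy-map isCoefficient distLast (I000 (suc m)) ⟩
  coeffRHS (suc m) a b                       ∎
  where
  open ≡-Reasoning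
  isCoefficient : (s : Stat) → Dec (proj₁ s ≡ a × proj₂ s ≡ just b)
  isCoefficient s = (proj₁ s ≟ a) ×-dec ≡-dec _≟_ (proj₂ s) (just b)
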